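{- Let $x_1,x_2,x_3,\ldots$ be pairwise commuting indeterminates. Let $\Gamma=(V,E)$ be the directed graph with vertex set $V=\mathbb{Z}\times\mathbb{Z}$ and edges $(i,j)\to(i,j+1)$ of weight $1$ and $(i,j)\to(i+1,j)$ of weight $x_j-x_{i+j}$, for all $(i,j)\in\mathbb{Z}^2$. For vertices $u,v$, let $e(u,v)$ be the sum, over all directed paths $P$ from $u$ to $v$, of the product of the weights of the edges of $P$. Let $a=(1,t)$ and $b=(m,n)$ with integers $m>0$ and $n>t>0$. Then $$e(a,b)=(x_t-x_{m+n-1})\cdots(x_t-x_{n+2})(x_t-x_{n+1})=\prod_{k=n+1}^{m+n-1}(x_t-x_k)$$ (empty product equal to $1$). In particular, after specializing $0=x_{n+1}=x_{n+2}=\cdots$, one has $e(a,b)=x_t^{m-1}$.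
   Context: A directed path $v_0\to v_1\to\cdots\to v_k$ (with $k\ge 0$) has weight equal to the product of the weights of its edges; the empty path from a vertex to itself has weight $1$. There are finitely many paths between any two vertices, so $e(u,v)$ is a polynomial. -}

module Defs where

open import Level using (Level)
open import Algebra.Bundles using (CommutativeRing)
open import Data.Integer as ℤ using (ℤ; +_; ∣_∣)
open import Data.Nat as ℕ using (ℕ; suc; _∸_)
open import Data.Product using (_×_; _,_; proj₁; proj₂)
open import Data.Product.Properties using (≡-dec)
open import Data.List using (List; []; _∷_; map; filter; foldr; concatMap; upTo)

Vertex : Set
Vertex = ℤ × ℤ

-- A directed path from a given start vertex is a word of steps:
--   J : (i , j) → (i , j + 1)   (weight 1)
--   I : (i , j) → (i + 1 , j)   (weight x_j - x_{i+j})
data Step : Set where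
  I J : Step

end : Vertex → List Step → Vertex
end u [] = u
end (i , j) (I ∷ w) = end (i ℤ.+ ℤ.+ 1 , j) w
end (i , j) (J ∷ w) = end (i , j ℤ.+ ℤ.+ 1) w

words : ℕ → List (List Step)
words ℕ.zero = [] ∷ []
words (suc n) = concatMap (λ w → (I ∷ w) ∷ (J ∷ w) ∷ []) (words n)

-- every step increases i + j by one, so a path u → v has length (v₁ - u₁) + (v₂ - u₂)
dist : Vertex → Vertex → ℤ
dist (i , j) (m , n) = (m ℤ.- i) ℤ.+ (n ℤ.- j)

module Graph {c ℓ : Level} (R : CommutativeRing c ℓ) (x : ℤ → CommutativeRing.Carrier R) where
  open CommutativeRing R

  weight : Vertex → List Step → Carrier
  weight u [] = 1#
  weight (i , j) (I ∷ w) = (x j - x (i ℤ.+ j)) * weight (i ℤ.+ ℤ.+ 1 , j) w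
  weight (i , j) (J ∷ w) = 1# * weight (i , j ℤ.+ ℤ.+ 1) w

  paths : Vertex → Vertex → List (List Step)
  paths u v = filter (λ w → ≡-dec ℤ._≟_ ℤ._≟_ (end u w) v) (words ∣ dist u v ∣)

  Σ : List Carrier → Carrier
  Σ = foldr _+_ 0#

  Π : List Carrier → Carrier
  Π = foldr _*_ 1#

  e : Vertex → Vertex → Carrier
  e u v = Σ (map (weight u) (paths u v))

  pow : Carrier → ℕ → Carrier
  pow a ℕ.zero = 1#
  pow a (suc k) = a * pow a k

  rhs : ℕ → ℕ → ℕ → Carrier
  rhs m n t = Π (map (λ i → x (+ t) - x (+ (n ℕ.+ suc i))) (upTo (m ∸ 1)))

-- Split the weighted path sum e(a, ·) according to the last edge of the path: reaching
-- (m+1, n+1) either from (m+1, n) along a weight-1 edge or from (m, n+1) along an edge of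
-- weight x_{n+1} - x_{m+n+1}.  Starting from a = (1, t), this recursion is solved by the
-- products ∏_{k=s}^{s+a-1} (x_t - x_k): in the inductive step the two contributions
-- (x_t - x_s) K and K (x_s - x_{s+a}) telescope to K (x_t - x_{s+a}).  Vertices left of
-- column 1 or below row t are unreachable, which supplies the boundary values.  Paths are
-- enumerated from their first edge, so the last-edge recursion is itself obtained by induction
-- on the length from the first-edge one.

module Submission where

open import Defs
open import Level using (Level)
open import Algebra.Bundles using (CommutativeRing)
open import Data.Integer using (ℤ; +_)
open import Data.Nat using (ℕ; _<_; _∸_)
open import Data.Product using (_×_; _,_)

import Algebra.Properties.AbelianGroup as AbelianGroupProperties
import Algebra.Properties.Ring as RingProperties
import Algebra.Solver.Ring.NaturalCoefficients.Default as SemiringSolver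
open import Data.Bool using (true; false; if_then_else_)
open import Data.Integer using (∣_∣; +<+)
import Data.Integer as ℤ
import Data.Integer.Properties as ℤₚ
open import Data.List using (List; []; _∷_; map; filter; concatMap; applyUpTo)
open import Data.List.Properties using (map-applyUpTo)
import Data.Nat as ℕ
open import Data.Nat using (suc; zero; z<s; _≤_)
import Data.Nat.Properties as ℕₚ
open import Data.Product.Properties using (≡-dec; ,-injectiveˡ; ,-injectiveʳ)
open import Data.Sum using (_⊎_; inj₁; inj₂; [_,_]; map₁; map₂)
open import Function using (id)
open import Relation.Binary.PropositionalEquality as ≡ using (_≡_; _≢_; cong; cong₂)
open import Relation.Nullary using (Dec; yes; no; does)
open import Relation.Nullary.Decidable using (dec-true; dec-false)
open import Relation.Unary using (Pred; Decidable)

open AbelianGroupProperties ℤₚ.+-0-abelianGroup using (∙-cancelʳ)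

+1≡suc⇒≡ : ∀ {i m} → i ℤ.+ + 1 ≡ ℤ.suc m → i ≡ m
+1≡suc⇒≡ {i} {m} eq = ∙-cancelʳ (+ 1) i m (≡.trans eq (ℤₚ.+-comm (+ 1) m))

<⇒<+1 : ∀ {k l} → k ℤ.< l → k ℤ.< l ℤ.+ + 1
<⇒<+1 {l = l} k<l = ℤₚ.<-≤-trans k<l (ℤₚ.i≤i+j l (+ 1))

+[m+n]-+n≡+m : ∀ m n → + (m ℕ.+ n) ℤ.- + n ≡ + m
+[m+n]-+n≡+m m n = ≡.trans (ℤₚ.m-n≡m⊖n (m ℕ.+ n) n)
  (≡.trans (ℤₚ.⊖-≥ (ℕₚ.m≤n+m n m)) (cong +_ (ℕₚ.m+n∸n≡m m n)))

module PathSums {c ℓ : Level} (R : CommutativeRing c ℓ) (x : ℤ → CommutativeRing.Carrier R) where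
  open CommutativeRing R
  open Graph R x
  open RingProperties ring using (-0#≈0#)
  open SemiringSolver commutativeSemiring using (solve; _:=_; _:+_; _:*_)
  open import Relation.Binary.Reasoning.Setoid setoid

  Σ-map-filter : ∀ {a p} {A : Set a} {P : Pred A p} (P? : Decidable P) (f : A → Carrier) xs →
    Σ (map f (filter P? xs)) ≈ Σ (map (λ w → if does (P? w) then f w else 0#) xs)
  Σ-map-filter P? f [] = refl
  Σ-map-filter P? f (w ∷ xs) with does (P? w)
  ... | true  = +-congˡ (Σ-map-filter P? f xs)
  ... | false = trans (Σ-map-filter P? f xs) (sym (+-identityˡ _))

  if-*ˡ : ∀ b a y → (if b then a * y else 0#) ≈ a * (if b then y else 0#)
  if-*ˡ true  a y = refl
  if-*ˡ false a y = sym (zeroʳ a)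

  telescope : ∀ K p q r → (p - q) * K + K * (q - r) ≈ K * (p - r)
  telescope K p q r = begin
    (p - q) * K + K * (q - r)        ≈⟨ factor (p - q) (q - r) ⟩
    K * ((p + - q) + (q + - r))      ≈⟨ *-congˡ (regroup p (- q) q (- r)) ⟩
    K * (p + ((- q + q) + - r))      ≈⟨ *-congˡ (+-congˡ (+-congʳ (-‿inverseˡ q))) ⟩
    K * (p + (0# + - r))             ≈⟨ *-congˡ (+-congˡ (+-identityˡ (- r))) ⟩
    K * (p - r)                      ∎
    where
    factor : ∀ a b → a * K + K * b ≈ K * (a + b)
    factor a b = solve 3 (λ a b K → a :* K :+ K :* b := K :* (a :+ b)) refl a b K
    regroup : ∀ a b c d → (a + b) + (c + d) ≈ a + ((b + c) + d)
    regroup = solve 4 (λ a b c d → (a :+ b) :+ (c :+ d) := a :+ ((b :+ c) :+ d)) refl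

  _≟ᵥ_ : (u v : Vertex) → Dec (u ≡ v)
  _≟ᵥ_ = ≡-dec ℤ._≟_ ℤ._≟_

  δ : Vertex → Vertex → Carrier
  δ u v = if does (u ≟ᵥ v) then 1# else 0#

  δ-refl : ∀ u → δ u u ≈ 1#
  δ-refl u rewrite dec-true (u ≟ᵥ u) ≡.refl = refl

  δ-unequal : ∀ {u v} → u ≢ v → δ u v ≈ 0#
  δ-unequal {u} {v} u≢v rewrite dec-false (u ≟ᵥ v) u≢v = refl

  δ-cong : ∀ {u v u′ v′} → (u ≡ v → u′ ≡ v′) → (u′ ≡ v′ → u ≡ v) → δ u v ≈ δ u′ v′
  δ-cong {u} {v} {u′} {v′} to from with u ≟ᵥ v
  ... | yes u≡v rewrite dec-true (u′ ≟ᵥ v′) (to u≡v) = refl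
  ... | no u≢v rewrite dec-false (u′ ≟ᵥ v′) (λ eq → u≢v (from eq)) = refl

  δ-stepI : ∀ i j m n → δ (i ℤ.+ + 1 , j) (ℤ.suc m , n) ≈ δ (i , j) (m , n)
  δ-stepI i j m n = δ-cong {i ℤ.+ + 1 , j} {ℤ.suc m , n} {i , j} {m , n}
    (λ eq → cong₂ _,_ (+1≡suc⇒≡ (,-injectiveˡ eq)) (,-injectiveʳ eq))
    (λ { ≡.refl → cong (_, j) (ℤₚ.+-comm i (+ 1)) })

  δ-stepJ : ∀ i j m n → δ (i , j ℤ.+ + 1) (m , ℤ.suc n) ≈ δ (i , j) (m , n)
  δ-stepJ i j m n = δ-cong {i , j ℤ.+ + 1} {m , ℤ.suc n} {i , j} {m , n}
    (λ eq → cong₂ _,_ (,-injectiveˡ eq) (+1≡suc⇒≡ (,-injectiveʳ eq)))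
    (λ { ≡.refl → cong (i ,_) (ℤₚ.+-comm j (+ 1)) })

  δ-transport : ∀ (f : Vertex → Carrier) u v → f u * δ u v ≈ δ u v * f v
  δ-transport f u v with u ≟ᵥ v
  ... | yes ≡.refl = *-comm (f u) 1#
  ... | no _       = trans (zeroʳ (f u)) (sym (zeroˡ (f v)))

  weightI : Vertex → Carrier
  weightI (i , j) = x j - x (i ℤ.+ j)

  pathSum : ℕ → Vertex → Vertex → Carrier
  pathSum zero    u       v = δ u v
  pathSum (suc N) (i , j) v = weightI (i , j) * pathSum N (i ℤ.+ + 1 , j) v + pathSum N (i , j ℤ.+ + 1) v

  contribution : Vertex → Vertex → List Step → Carrier
  contribution u v w = if does (end u w ≟ᵥ v) then weight u w else 0#

  Σ-contribution-extensions : ∀ i j v L →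
    Σ (map (contribution (i , j) v) (concatMap (λ w → (I ∷ w) ∷ (J ∷ w) ∷ []) L))
      ≈ weightI (i , j) * Σ (map (contribution (i ℤ.+ + 1 , j) v) L)
        + Σ (map (contribution (i , j ℤ.+ + 1) v) L)
  Σ-contribution-extensions i j v [] = sym (trans (+-identityʳ _) (zeroʳ _))
  Σ-contribution-extensions i j v (w ∷ L) =
    trans (+-cong (if-*ˡ _ _ _)
                  (+-cong (trans (if-*ˡ _ 1# _) (*-identityˡ _)) (Σ-contribution-extensions i j v L)))
          (regroup (weightI (i , j)) _ _ _ _)
    where
    regroup : ∀ w a b A B → w * a + (b + (w * A + B)) ≈ w * (a + A) + (b + B)
    regroup = solve 5 (λ w a b A B → w :* a :+ (b :+ (w :* A :+ B)) := w :* (a :+ A) :+ (b :+ B)) refl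

  Σ-contribution-words : ∀ N u v → Σ (map (contribution u v) (words N)) ≈ pathSum N u v
  Σ-contribution-words zero    u       v = +-identityʳ _
  Σ-contribution-words (suc N) (i , j) v = trans (Σ-contribution-extensions i j v (words N))
    (+-cong (*-congˡ (Σ-contribution-words N _ v)) (Σ-contribution-words N _ v))

  e≈pathSum : ∀ u v → e u v ≈ pathSum ∣ dist u v ∣ u v
  e≈pathSum u v = trans (Σ-map-filter (λ w → end u w ≟ᵥ v) (weight u) (words ∣ dist u v ∣))
    (Σ-contribution-words ∣ dist u v ∣ u v)

  pathSum-lastStep : ∀ N u m n →
    pathSum (suc N) u (ℤ.suc m , ℤ.suc n)
      ≈ pathSum N u (ℤ.suc m , n) + pathSum N u (m , ℤ.suc n) * weightI (m , ℤ.suc n)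
  pathSum-lastStep zero (i , j) m n = begin
    weightI (i , j) * δ (i ℤ.+ + 1 , j) (ℤ.suc m , ℤ.suc n) + δ (i , j ℤ.+ + 1) (ℤ.suc m , ℤ.suc n)
      ≈⟨ +-cong (*-congˡ (δ-stepI i j m (ℤ.suc n))) (δ-stepJ i j (ℤ.suc m) n) ⟩
    weightI (i , j) * δ (i , j) (m , ℤ.suc n) + δ (i , j) (ℤ.suc m , n)
      ≈⟨ +-congʳ (δ-transport weightI (i , j) (m , ℤ.suc n)) ⟩
    δ (i , j) (m , ℤ.suc n) * weightI (m , ℤ.suc n) + δ (i , j) (ℤ.suc m , n)
      ≈⟨ +-comm _ _ ⟩
    δ (i , j) (ℤ.suc m , n) + δ (i , j) (m , ℤ.suc n) * weightI (m , ℤ.suc n) ∎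
  pathSum-lastStep (suc N) (i , j) m n =
    trans (+-cong (*-congˡ (pathSum-lastStep N (i ℤ.+ + 1 , j) m n)) (pathSum-lastStep N (i , j ℤ.+ + 1) m n))
          (regroup (weightI (i , j)) _ _ _ _ _)
    where
    regroup : ∀ w a b c A B → w * (a + b * c) + (A + B * c) ≈ (w * a + A) + (w * b + B) * c
    regroup = solve 6 (λ w a b c A B →
      w :* (a :+ b :* c) :+ (A :+ B :* c) := (w :* a :+ A) :+ (w :* b :+ B) :* c) refl

  pathSum-unreachable : ∀ N {i j m n} → m ℤ.< i ⊎ n ℤ.< j → pathSum N (i , j) (m , n) ≈ 0#
  pathSum-unreachable zero {i} {j} {m} {n} beyond =
    δ-unequal {i , j} {m , n} (λ { ≡.refl → [ ℤₚ.<-irrefl ≡.refl , ℤₚ.<-irrefl ≡.refl ] beyond })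
  pathSum-unreachable (suc N) {i} {j} beyond = begin
    weightI (i , j) * pathSum N _ _ + pathSum N _ _
      ≈⟨ +-cong (*-congˡ (pathSum-unreachable N (map₁ <⇒<+1 beyond)))
                (pathSum-unreachable N (map₂ <⇒<+1 beyond)) ⟩
    weightI (i , j) * 0# + 0#    ≈⟨ +-identityʳ _ ⟩
    weightI (i , j) * 0#         ≈⟨ zeroʳ _ ⟩
    0#                           ∎

  diffProduct : ℕ → ℕ → ℕ → Carrier
  diffProduct t zero    s = 1#
  diffProduct t (suc a) s = (x (+ t) - x (+ s)) * diffProduct t a (suc s)

  diffProduct-snoc : ∀ t a s →
    diffProduct t (suc a) (suc s) ≈ diffProduct t a (suc s) * (x (+ t) - x (+ (suc a ℕ.+ s)))
  diffProduct-snoc t zero    s = *-comm _ _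
  diffProduct-snoc t (suc a) s = begin
    d (suc s) * diffProduct t (suc a) (suc (suc s))
      ≈⟨ *-congˡ (diffProduct-snoc t a (suc s)) ⟩
    d (suc s) * (diffProduct t a (suc (suc s)) * d (suc a ℕ.+ suc s))
      ≈⟨ *-assoc _ _ _ ⟨
    diffProduct t (suc a) (suc s) * d (suc a ℕ.+ suc s)
      ≡⟨ cong (λ k → diffProduct t (suc a) (suc s) * d k) (ℕₚ.+-suc (suc a) s) ⟩
    diffProduct t (suc a) (suc s) * d (suc (suc a) ℕ.+ s) ∎
    where
    d : ℕ → Carrier
    d k = x (+ t) - x (+ k)

  Π-applyUpTo-diffProduct : ∀ t a s (f : ℕ → Carrier) → (∀ i → f i ≡ x (+ t) - x (+ (s ℕ.+ i))) →
    Π (applyUpTo f a) ≈ diffProduct t a s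
  Π-applyUpTo-diffProduct t zero    s f f≡ = refl
  Π-applyUpTo-diffProduct t (suc a) s f f≡ = *-cong
    (reflexive (≡.trans (f≡ 0) (cong (λ k → x (+ t) - x (+ k)) (ℕₚ.+-identityʳ s))))
    (Π-applyUpTo-diffProduct t a (suc s) (λ i → f (suc i))
      (λ i → ≡.trans (f≡ (suc i)) (cong (λ k → x (+ t) - x (+ k)) (ℕₚ.+-suc s i))))

  rhs≈diffProduct : ∀ t a n → rhs (suc a) n t ≈ diffProduct t a (suc n)
  rhs≈diffProduct t a n = trans (reflexive (cong Π (map-applyUpTo id _ a)))
    (Π-applyUpTo-diffProduct t a (suc n) _ (λ i → cong (λ k → x (+ t) - x (+ k)) (ℕₚ.+-suc n i)))

  diffProduct-vanishing : ∀ {n} → (∀ k → n < k → x (+ k) ≈ 0#) →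
    ∀ t a {s} → n < s → diffProduct t a s ≈ pow (x (+ t)) a
  diffProduct-vanishing vanish t zero    n<s = refl
  diffProduct-vanishing vanish t (suc a) {s} n<s = *-cong
    (trans (+-congˡ (trans (-‿cong (vanish s n<s)) -0#≈0#)) (+-identityʳ _))
    (diffProduct-vanishing vanish t a (ℕₚ.m<n⇒m<1+n n<s))

  module _ (t : ℕ) where

    source : Vertex
    source = (+ 1 , + suc t)

    pathSum-closedForm : ∀ a b →
      pathSum (a ℕ.+ b) source (+ suc a , + (b ℕ.+ suc t)) ≈ diffProduct (suc t) a (suc (b ℕ.+ suc t))
    pathSum-closedForm zero zero = δ-refl source
    pathSum-closedForm zero (suc b) = begin
      pathSum (suc b) source (+ 1 , + suc (b ℕ.+ suc t))
        ≈⟨ pathSum-lastStep b source (+ 0) (+ (b ℕ.+ suc t)) ⟩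
      pathSum b source (+ 1 , + (b ℕ.+ suc t)) + pathSum b source (+ 0 , + suc (b ℕ.+ suc t)) * w
        ≈⟨ +-cong (pathSum-closedForm 0 b) (*-congʳ (pathSum-unreachable b (inj₁ (+<+ z<s)))) ⟩
      1# + 0# * w  ≈⟨ +-congˡ (zeroˡ w) ⟩
      1# + 0#      ≈⟨ +-identityʳ 1# ⟩
      1#           ∎
      where
      w : Carrier
      w = weightI (+ 0 , + suc (b ℕ.+ suc t))
    pathSum-closedForm (suc a) zero = begin
      pathSum (suc (a ℕ.+ 0)) source (+ suc (suc a) , + suc t)
        ≈⟨ pathSum-lastStep (a ℕ.+ 0) source (+ suc a) (+ t) ⟩
      pathSum (a ℕ.+ 0) source (+ suc (suc a) , + t) + pathSum (a ℕ.+ 0) source (+ suc a , + suc t) * w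
        ≈⟨ +-cong (pathSum-unreachable (a ℕ.+ 0) (inj₂ (+<+ (ℕₚ.n<1+n t))))
                  (*-congʳ (pathSum-closedForm a 0)) ⟩
      0# + diffProduct (suc t) a (suc (suc t)) * w
        ≈⟨ +-identityˡ _ ⟩
      diffProduct (suc t) a (suc (suc t)) * w
        ≈⟨ diffProduct-snoc (suc t) a (suc t) ⟨
      diffProduct (suc t) (suc a) (suc (suc t)) ∎
      where
      w : Carrier
      w = weightI (+ suc a , + suc t)
    pathSum-closedForm (suc a) (suc b) = begin
      pathSum (suc (a ℕ.+ suc b)) source (+ suc (suc a) , + s)
        ≈⟨ pathSum-lastStep (a ℕ.+ suc b) source (+ suc a) (+ (b ℕ.+ suc t)) ⟩
      pathSum (a ℕ.+ suc b) source (+ suc (suc a) , + (b ℕ.+ suc t))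
        + pathSum (a ℕ.+ suc b) source (+ suc a , + s) * w
        ≈⟨ +-cong (≡.subst (λ N → pathSum N source (+ suc (suc a) , + (b ℕ.+ suc t)) ≈ diffProduct (suc t) (suc a) s)
                           (≡.sym (ℕₚ.+-suc a b)) (pathSum-closedForm (suc a) b))
                  (*-congʳ (pathSum-closedForm a (suc b))) ⟩
      (x (+ suc t) - x (+ s)) * K + K * (x (+ s) - x (+ (suc a ℕ.+ s)))
        ≈⟨ telescope K _ _ _ ⟩
      K * (x (+ suc t) - x (+ (suc a ℕ.+ s)))
        ≈⟨ diffProduct-snoc (suc t) a s ⟨
      diffProduct (suc t) (suc a) (suc s) ∎
      where
      s : ℕ
      s = suc (b ℕ.+ suc t)
      w K : Carrier
      w = weightI (+ suc a , + s)
      K = diffProduct (suc t) a (suc s)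

    e-closedForm-row : ∀ a b →
      e source (+ suc a , + (b ℕ.+ suc t)) ≈ diffProduct (suc t) a (suc (b ℕ.+ suc t))
    e-closedForm-row a b = begin
      e source target
        ≈⟨ e≈pathSum source target ⟩
      pathSum ∣ + a ℤ.+ (+ (b ℕ.+ suc t) ℤ.- + suc t) ∣ source target
        ≡⟨ cong (λ k → pathSum ∣ + a ℤ.+ k ∣ source target) (+[m+n]-+n≡+m b (suc t)) ⟩
      pathSum (a ℕ.+ b) source target
        ≈⟨ pathSum-closedForm a b ⟩
      diffProduct (suc t) a (suc (b ℕ.+ suc t)) ∎
      where
      target : Vertex
      target = (+ suc a , + (b ℕ.+ suc t))

    e-closedForm : ∀ a {n} → suc t ≤ n → e source (+ suc a , + n) ≈ diffProduct (suc t) a (suc n)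
    e-closedForm a {n} t+1≤n = ≡.subst (λ k → e source (+ suc a , + k) ≈ diffProduct (suc t) a (suc k))
      (ℕₚ.m∸n+n≡m t+1≤n) (e-closedForm-row a (n ∸ suc t))

mainTheorem2 : ∀ {c ℓ : Level} (R : CommutativeRing c ℓ) (x : ℤ → CommutativeRing.Carrier R)
    (m n t : ℕ) → 0 < m → 0 < t → t < n →
    CommutativeRing._≈_ R (Graph.e R x (+ 1 , + t) (+ m , + n)) (Graph.rhs R x m n t)
    × ((∀ (k : ℕ) → n < k → CommutativeRing._≈_ R (x (+ k)) (CommutativeRing.0# R)) →
       CommutativeRing._≈_ R (Graph.e R x (+ 1 , + t) (+ m , + n)) (Graph.pow R x (x (+ t)) (m ∸ 1)))
mainTheorem2 R x (suc a) n (suc t) z<s z<s t<n =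
    trans closedForm (sym (rhs≈diffProduct (suc t) a n))
  , λ vanish → trans closedForm (diffProduct-vanishing vanish (suc t) a (ℕₚ.n<1+n n))
  where
  open CommutativeRing R using (_≈_; trans; sym)
  open Graph R x using (e)
  open PathSums R x
  closedForm : e (+ 1 , + suc t) (+ suc a , + n) ≈ diffProduct (suc t) a (suc n)
  closedForm = e-closedForm t a (ℕₚ.<⇒≤ t<n)
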